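{- Let $G$ be a finite simple graph of order $n$ whose odd girth is $2k+1$ for some integer $k\ge 1$. Then $\mathrm{es}_{\Delta}(G)\le \frac{k+1}{2k+1}\,n$.
   Context: The odd girth of $G$ is the length of a shortest odd cycle in $G$. The $\Delta$-edge stability number $\mathrm{es}_{\Delta}(G)$ is the minimum number of edges of $G$ whose removal results in a subgraph $H$ with $\Delta(H)=\Delta(G)-1$, where $\Delta(\cdot)$ denotes maximum degree. -}

module Defs where

open import Data.Nat using (ℕ; zero; suc; _+_; _*_; _∸_; _≤_; _<_; _⊔_; _<ᵇ_)
open import Data.Bool using (Bool; true; false; if_then_else_; _∧_)
open import Data.Fin using (Fin; toℕ; fromℕ<)
open import Data.Nat.DivMod using (m%n<n)
open import Data.Nat.ListAction using (sum)
open import Data.Empty using (⊥)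
open import Data.List using (List; map; foldr; allFin)
open import Data.Product using (Σ; ∃; _×_; _,_)
open import Relation.Binary.PropositionalEquality using (_≡_)
open import Relation.Nullary using (¬_)
open import Function.Definitions using (Injective)

record Graph (n : ℕ) : Set where
  field
    adj   : Fin n → Fin n → Bool
    sym   : ∀ i j → adj i j ≡ adj j i
    loopless : ∀ i → adj i i ≡ false
open Graph public

count : {n : ℕ} → (Fin n → Bool) → ℕ
count {n} p = sum (map (λ j → if p j then 1 else 0) (allFin n))

deg : {n : ℕ} → Graph n → Fin n → ℕ
deg G i = count (adj G i)

Δ : {n : ℕ} → Graph n → ℕ
Δ {n} G = foldr _⊔_ 0 (map (deg G) (allFin n))

numEdges : {n : ℕ} → Graph n → ℕ
numEdges {n} G = sum (map (λ i → count (λ j → (toℕ i <ᵇ toℕ j) ∧ adj G i j)) (allFin n))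

_⊆ᴱ_ : {n : ℕ} → Graph n → Graph n → Set
H ⊆ᴱ G = ∀ i j → adj H i j ≡ true → adj G i j ≡ true

next : {L : ℕ} → Fin (suc L) → Fin (suc L)
next {L} i = fromℕ< (m%n<n (suc (toℕ i)) (suc L))

IsCycle : {n : ℕ} → Graph n → (L : ℕ) → (Fin (suc L) → Fin n) → Set
IsCycle G L c = 3 ≤ suc L × Injective _≡_ _≡_ c × (∀ i → adj G (c i) (c (next i)) ≡ true)

HasCycleOfLength : {n : ℕ} → Graph n → ℕ → Set
HasCycleOfLength G zero = ⊥
HasCycleOfLength G (suc L) = Σ (Fin (suc L) → Fin _) (IsCycle G L)

Odd : ℕ → Set
Odd m = ∃ λ t → m ≡ suc (2 * t)

OddGirth : {n : ℕ} → Graph n → ℕ → Set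
OddGirth G g = Odd g × HasCycleOfLength G g
             × (∀ m → Odd m → HasCycleOfLength G m → g ≤ m)

-- A Δ-edge-stability removal of G: a spanning subgraph H of G (H is G with
-- the edge set E(G) \ E(H) deleted) such that Δ(H) = Δ(G) - 1.
IsΔRemoval : {n : ℕ} → Graph n → Graph n → Set
IsΔRemoval G H = H ⊆ᴱ G × Δ H ≡ Δ G ∸ 1

-- number of removed edges |E(G) \ E(H)| (valid since E(H) ⊆ E(G))
removed : {n : ℕ} → Graph n → Graph n → ℕ
removed G H = numEdges G ∸ numEdges H

-- Let S be the set of vertices of maximum degree Δ ≥ 1. Each of them has Δ neighbours and every
-- vertex has at most Δ neighbours in S, so Hall's theorem gives an injection f from S into the
-- vertices with s adjacent to f s. The arcs s ↦ f s split S into directed paths and cycles, which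
-- are covered greedily: a path end s that is not an image takes the edge s (f s), one edge for two
-- vertices, and a cycle of length p takes ⌈p/2⌉ of its edges. An odd cycle has length p ≥ 2k+1, so
-- in every case at most (k+1)/(2k+1) edges are spent per vertex. Deleting the chosen edges lowers
-- every maximum degree, and since deleting a single edge lowers Δ by at most one, deleting a suffix
-- of the chosen edges lowers Δ by exactly one.

module Submission where

open import Defs renaming (sym to adj-sym)

open import Data.Bool using (Bool; true; false; if_then_else_; _∧_; _∨_; not; T)
import Data.Bool.Properties as Bool
open import Data.Fin using (Fin; zero; suc; toℕ)
import Data.Fin.Properties as Fin
open import Data.Fin.Subset.Properties using (anySubset?)
open import Data.List as List using (List; []; _∷_; _++_; length; allFin)
import Data.List.Properties as List
open import Data.List.Relation.Unary.Any using (Any; here; there)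
import Data.List.Relation.Unary.Any.Properties as Any
open import Data.Nat
  using (ℕ; zero; suc; _+_; _*_; _∸_; _≤_; _<_; _⊔_; z≤n; s≤s; z<s; _<ᵇ_; >-nonZero)
open import Data.Nat.DivMod using (_%_; m≤n⇒m%n≡m; n%n≡0)
open import Data.Nat.Induction using (<-rec)
import Data.Nat.ListAction as List
open import Data.Nat.Properties
open import Algebra.Properties.Semiring.Sum +-*-semiring
  using (sum; sum-cong-≗; ∑-distrib-+; ∑-comm; *-distribˡ-sum)
open import Data.Nat.Solver using (module +-*-Solver)
open import Data.Product using (Σ; ∃; _×_; _,_; proj₁; proj₂)
open import Data.Sum using (_⊎_; inj₁; inj₂)
open import Data.Unit using (tt)
import Data.Vec as Vec
import Data.Vec.Functional as Vector
import Data.Vec.Properties as Vec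
open import Function using (_∘_; id; mk⇔; case_of_)
open import Function.Definitions using (Injective)
open import Relation.Binary.Definitions using (tri<; tri≈; tri>)
open import Relation.Binary.PropositionalEquality
  using (_≡_; _≢_; refl; sym; trans; cong; cong₂; subst; subst₂; module ≡-Reasoning)
open import Relation.Nullary using (¬_; Dec; yes; no; does; contradiction)
open import Relation.Nullary.Decidable using (does-⇔; dec-true; dec-false; _×-dec_; _→-dec_)
open import Relation.Unary using (Decidable)

-- Finite sets as Boolean predicates

infix 4 _∈_ _∉_ _⊆_
infixr 7 _∩_
infixr 6 _∪_ _─_

_∈_ _∉_ : ∀ {n} → Fin n → (Fin n → Bool) → Set
i ∈ P = P i ≡ true
i ∉ P = P i ≡ false

_⊆_ : ∀ {n} → (Fin n → Bool) → (Fin n → Bool) → Set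
P ⊆ Q = ∀ i → i ∈ P → i ∈ Q

full : ∀ {n} → Fin n → Bool
full _ = true

∈-or-∉ : ∀ {n} (P : Fin n → Bool) i → i ∈ P ⊎ i ∉ P
∈-or-∉ P i with P i
... | true  = inj₁ refl
... | false = inj₂ refl

≡false⇒≢true : ∀ {b} → b ≡ false → b ≢ true
≡false⇒≢true b≡false b≡true = Bool.not-¬ b≡true b≡false

≢true⇒≡false : ∀ {b} → b ≢ true → b ≡ false
≢true⇒≡false = Bool.¬-not

⊆? : ∀ {n} (P Q : Fin n → Bool) → Dec (P ⊆ Q)
⊆? P Q = Fin.all? (λ i → (P i Bool.≟ true) →-dec (Q i Bool.≟ true))

∧⁻ : ∀ a {b} → a ∧ b ≡ true → a ≡ true × b ≡ true
∧⁻ true b≡true = refl , b≡true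

∨⁻ : ∀ a {b} → a ∨ b ≡ true → a ≡ true ⊎ b ≡ true
∨⁻ true  _      = inj₁ refl
∨⁻ false b≡true = inj₂ b≡true

does⇒ : ∀ {A : Set} (a? : Dec A) → does a? ≡ true → A
does⇒ (yes a) _  = a
does⇒ (no _)  ()

¬does⇒ : ∀ {A : Set} (a? : Dec A) → does a? ≡ false → ¬ A
¬does⇒ (yes _)  ()
¬does⇒ (no ¬a) _ = ¬a

indicator : Bool → ℕ
indicator b = if b then 1 else 0

∣_∣ : ∀ {n} → (Fin n → Bool) → ℕ
∣ P ∣ = sum (λ i → indicator (P i))

sum-mono-≤ : ∀ {n} {f g : Fin n → ℕ} → (∀ i → f i ≤ g i) → sum f ≤ sum g
sum-mono-≤ {zero}  f≤g = z≤n
sum-mono-≤ {suc n} f≤g = +-mono-≤ (f≤g zero) (sum-mono-≤ (λ i → f≤g (suc i)))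

∣∣-cong : ∀ {n} {P Q : Fin n → Bool} → (∀ i → P i ≡ Q i) → ∣ P ∣ ≡ ∣ Q ∣
∣∣-cong P≗Q = sum-cong-≗ (λ i → cong indicator (P≗Q i))

indicator-mono : ∀ {a b} → (a ≡ true → b ≡ true) → indicator a ≤ indicator b
indicator-mono {false}     _   = z≤n
indicator-mono {true}  {b} a⇒b rewrite a⇒b refl = ≤-refl

∣∣-mono : ∀ {n} {P Q : Fin n → Bool} → P ⊆ Q → ∣ P ∣ ≤ ∣ Q ∣
∣∣-mono P⊆Q = sum-mono-≤ (λ i → indicator-mono (P⊆Q i))

∣∣≡0 : ∀ {n} {P : Fin n → Bool} → (∀ i → i ∉ P) → ∣ P ∣ ≡ 0
∣∣≡0 {zero}      empty = refl
∣∣≡0 {suc n} {P} empty rewrite empty zero = ∣∣≡0 (λ i → empty (suc i))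

∈⇒1≤∣∣ : ∀ {n} {P : Fin n → Bool} {i} → i ∈ P → 1 ≤ ∣ P ∣
∈⇒1≤∣∣ {i = zero}  i∈P rewrite i∈P = s≤s z≤n
∈⇒1≤∣∣ {P = P} {suc i} i∈P = ≤-trans (∈⇒1≤∣∣ {P = P ∘ suc} i∈P) (m≤n+m _ (indicator (P zero)))

1≤∣∣⇒∈ : ∀ {n} {P : Fin n → Bool} → 1 ≤ ∣ P ∣ → ∃ (_∈ P)
1≤∣∣⇒∈ {suc n} {P} 1≤∣P∣ with P zero in eq
... | true  = zero , eq
... | false with 1≤∣∣⇒∈ {P = P ∘ suc} 1≤∣P∣
...   | i , i∈P = suc i , i∈P

∣full∣≡n : ∀ {n} → ∣ full {n} ∣ ≡ n
∣full∣≡n {zero}  = refl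
∣full∣≡n {suc n} = cong suc ∣full∣≡n

-- Opaque, so that goals such as i ∈ P ∩ Q keep their shape and P, Q can be inferred.
opaque
  _∩_ _∪_ _─_ : ∀ {n} → (Fin n → Bool) → (Fin n → Bool) → Fin n → Bool
  (P ∩ Q) i = P i ∧ Q i
  (P ∪ Q) i = P i ∨ Q i
  (P ─ Q) i = P i ∧ not (Q i)

  ⁅_⁆ : ∀ {n} → Fin n → Fin n → Bool
  ⁅ x ⁆ i = does (i Fin.≟ x)

  ∩-∧ : ∀ {n} (P Q : Fin n → Bool) i → (P ∩ Q) i ≡ P i ∧ Q i
  ∩-∧ P Q i = refl

  ∩⁺ : ∀ {n} {P Q : Fin n → Bool} {i} → i ∈ P → i ∈ Q → i ∈ P ∩ Q
  ∩⁺ i∈P i∈Q rewrite i∈P = i∈Q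

  ∩⁻ : ∀ {n} {P Q : Fin n → Bool} {i} → i ∈ P ∩ Q → i ∈ P × i ∈ Q
  ∩⁻ {P = P} {i = i} = ∧⁻ (P i)

  ─⁺ : ∀ {n} {P Q : Fin n → Bool} {i} → i ∈ P → i ∉ Q → i ∈ P ─ Q
  ─⁺ i∈P i∉Q rewrite i∈P | i∉Q = refl

  ─⁻ : ∀ {n} {P Q : Fin n → Bool} {i} → i ∈ P ─ Q → i ∈ P × i ∉ Q
  ─⁻ {P = P} {Q} {i} h with P i | Q i
  ... | true | false = refl , refl

  ∈⇒∉─ : ∀ {n} {P Q : Fin n → Bool} {i} → i ∈ Q → i ∉ P ─ Q
  ∈⇒∉─ {P = P} {i = i} i∈Q rewrite i∈Q = Bool.∧-zeroʳ (P i)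

  ∪⁺ˡ : ∀ {n} {P Q : Fin n → Bool} {i} → i ∈ P → i ∈ P ∪ Q
  ∪⁺ˡ i∈P rewrite i∈P = refl

  ∪⁺ʳ : ∀ {n} {P Q : Fin n → Bool} {i} → i ∈ Q → i ∈ P ∪ Q
  ∪⁺ʳ {P = P} {i = i} i∈Q rewrite i∈Q = Bool.∨-zeroʳ (P i)

  ∪⁻ : ∀ {n} {P Q : Fin n → Bool} {i} → i ∈ P ∪ Q → i ∈ P ⊎ i ∈ Q
  ∪⁻ {P = P} {i = i} = ∨⁻ (P i)

  ∈⁅⁆⇒≡ : ∀ {n} {x i : Fin n} → i ∈ ⁅ x ⁆ → i ≡ x
  ∈⁅⁆⇒≡ {x = x} {i} = does⇒ (i Fin.≟ x)

  ≡⇒∈⁅⁆ : ∀ {n} {x i : Fin n} → i ≡ x → i ∈ ⁅ x ⁆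
  ≡⇒∈⁅⁆ {x = x} {i} = dec-true (i Fin.≟ x)

  ≢⇒∉⁅⁆ : ∀ {n} {x i : Fin n} → i ≢ x → i ∉ ⁅ x ⁆
  ≢⇒∉⁅⁆ {x = x} {i} = dec-false (i Fin.≟ x)

  ∣∣-split : ∀ {n} (P Q : Fin n → Bool) → ∣ P ∣ ≡ ∣ P ∩ Q ∣ + ∣ P ─ Q ∣
  ∣∣-split P Q = trans (sum-cong-≗ split) (∑-distrib-+ (λ i → indicator ((P ∩ Q) i)) _)
    where
    split : ∀ i → indicator (P i) ≡ indicator ((P ∩ Q) i) + indicator ((P ─ Q) i)
    split i with P i | Q i
    ... | false | _     = refl
    ... | true  | true  = refl
    ... | true  | false = refl

  ∣∪∣≤∣∣+∣∣ : ∀ {n} (P Q : Fin n → Bool) → ∣ P ∪ Q ∣ ≤ ∣ P ∣ + ∣ Q ∣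
  ∣∪∣≤∣∣+∣∣ P Q = ≤-trans (sum-mono-≤ union) (≤-reflexive (∑-distrib-+ (λ i → indicator (P i)) _))
    where
    union : ∀ i → indicator ((P ∪ Q) i) ≤ indicator (P i) + indicator (Q i)
    union i with P i
    ... | true  = s≤s z≤n
    ... | false = ≤-refl

  ∣⁅x⁆∣≡1 : ∀ {n} (x : Fin n) → ∣ ⁅ x ⁆ ∣ ≡ 1
  ∣⁅x⁆∣≡1 {suc n} zero = cong suc (∣∣≡0 {n} (λ _ → refl))
  ∣⁅x⁆∣≡1 (suc x)      = ∣⁅x⁆∣≡1 x

x∈⁅x⁆ : ∀ {n} (x : Fin n) → x ∈ ⁅ x ⁆
x∈⁅x⁆ x = ≡⇒∈⁅⁆ refl

∈⇒⁅⁆⊆ : ∀ {n} {P : Fin n → Bool} {x} → x ∈ P → ⁅ x ⁆ ⊆ P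
∈⇒⁅⁆⊆ {P = P} x∈P i i∈⁅x⁆ = subst (_∈ P) (sym (∈⁅⁆⇒≡ i∈⁅x⁆)) x∈P

1≤∣⁅x⁆∣ : ∀ {n} (x : Fin n) → 1 ≤ ∣ ⁅ x ⁆ ∣
1≤∣⁅x⁆∣ x = ∈⇒1≤∣∣ {P = ⁅ x ⁆} (x∈⁅x⁆ x)

⊆⁅⁆⇒∣∣≤1 : ∀ {n} {P : Fin n → Bool} {x} → P ⊆ ⁅ x ⁆ → ∣ P ∣ ≤ 1
⊆⁅⁆⇒∣∣≤1 {x = x} P⊆⁅x⁆ = ≤-trans (∣∣-mono P⊆⁅x⁆) (≤-reflexive (∣⁅x⁆∣≡1 x))

⊆⇒∣∣+∣─∣≤∣∣ : ∀ {n} {P Q : Fin n → Bool} → Q ⊆ P → ∣ Q ∣ + ∣ P ─ Q ∣ ≤ ∣ P ∣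
⊆⇒∣∣+∣─∣≤∣∣ {P = P} {Q} Q⊆P = begin
  ∣ Q ∣ + ∣ P ─ Q ∣     ≤⟨ +-monoˡ-≤ ∣ P ─ Q ∣ (∣∣-mono (λ i i∈Q → ∩⁺ (Q⊆P i i∈Q) i∈Q)) ⟩
  ∣ P ∩ Q ∣ + ∣ P ─ Q ∣ ≡⟨ ∣∣-split P Q ⟨
  ∣ P ∣                 ∎
  where open ≤-Reasoning

∣─∣<∣∣ : ∀ {n} {P Q : Fin n → Bool} → Q ⊆ P → 1 ≤ ∣ Q ∣ → ∣ P ─ Q ∣ < ∣ P ∣
∣─∣<∣∣ Q⊆P 1≤∣Q∣ = ≤-trans (+-monoˡ-≤ _ 1≤∣Q∣) (⊆⇒∣∣+∣─∣≤∣∣ Q⊆P)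

∣─∣≤pred : ∀ {n} {P Q : Fin n → Bool} {m} → Q ⊆ P → 1 ≤ ∣ Q ∣ → ∣ P ∣ ≤ suc m → ∣ P ─ Q ∣ ≤ m
∣─∣≤pred Q⊆P 1≤∣Q∣ ∣P∣≤1+m = ≤-pred (≤-trans (∣─∣<∣∣ Q⊆P 1≤∣Q∣) ∣P∣≤1+m)

disjoint⇒∣∣+∣∣≤∣∪∣ : ∀ {n} {P Q : Fin n → Bool} → (∀ i → i ∈ P → i ∉ Q) → ∣ P ∣ + ∣ Q ∣ ≤ ∣ P ∪ Q ∣
disjoint⇒∣∣+∣∣≤∣∪∣ {P = P} {Q} disjoint = begin
  ∣ P ∣ + ∣ Q ∣             ≤⟨ +-monoˡ-≤ ∣ Q ∣ (∣∣-mono (λ i i∈P → ─⁺ (∪⁺ˡ i∈P) (disjoint i i∈P))) ⟩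
  ∣ (P ∪ Q) ─ Q ∣ + ∣ Q ∣   ≡⟨ +-comm _ ∣ Q ∣ ⟩
  ∣ Q ∣ + ∣ (P ∪ Q) ─ Q ∣   ≤⟨ ⊆⇒∣∣+∣─∣≤∣∣ {P = P ∪ Q} (λ i → ∪⁺ʳ) ⟩
  ∣ P ∪ Q ∣                 ∎
  where open ≤-Reasoning

⊂⇒∣∣<∣∣ : ∀ {n} {P Q : Fin n → Bool} {x} → P ⊆ Q → x ∉ P → x ∈ Q → ∣ P ∣ < ∣ Q ∣
⊂⇒∣∣<∣∣ {P = P} {Q} P⊆Q x∉P x∈Q = begin-strict
  ∣ P ∣                 <⟨ m<m+n ∣ P ∣ (∈⇒1≤∣∣ {P = Q ─ P} (─⁺ x∈Q x∉P)) ⟩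
  ∣ P ∣ + ∣ Q ─ P ∣     ≤⟨ ⊆⇒∣∣+∣─∣≤∣∣ P⊆Q ⟩
  ∣ Q ∣                 ∎
  where open ≤-Reasoning

any : ∀ {n} → (Fin n → Bool) → Bool
any P = does (Fin.any? (λ i → P i Bool.≟ true))

any-witness : ∀ {n} {P : Fin n → Bool} → any P ≡ true → ∃ (_∈ P)
any-witness {P = P} h with Fin.any? (λ i → P i Bool.≟ true)
... | yes w = w

any-intro : ∀ {n} {P : Fin n → Bool} {i} → i ∈ P → any P ≡ true
any-intro {P = P} {i} i∈P with Fin.any? (λ i → P i Bool.≟ true)
... | yes _ = refl
... | no ∄ = contradiction (i , i∈P) ∄

any-cong : ∀ {n} {P Q : Fin n → Bool} → (∀ i → P i ≡ Q i) → any P ≡ any Q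
any-cong {P = P} {Q} P≗Q =
  does-⇔ (mk⇔ (λ (i , e) → i , trans (sym (P≗Q i)) e) (λ (i , e) → i , trans (P≗Q i) e))
  (Fin.any? (λ i → P i Bool.≟ true)) (Fin.any? (λ i → Q i Bool.≟ true))

-- Degrees and edge deletion

max : ∀ {n} → (Fin n → ℕ) → ℕ
max = Vector.foldr _⊔_ 0

≤-max : ∀ {n} (f : Fin n → ℕ) i → f i ≤ max f
≤-max f zero    = m≤m⊔n _ _
≤-max f (suc i) = ≤-trans (≤-max (f ∘ suc) i) (m≤n⊔m (f zero) _)

max-lub : ∀ {n} {f : Fin n → ℕ} {m} → (∀ i → f i ≤ m) → max f ≤ m
max-lub {zero}  f≤m = z≤n
max-lub {suc n} f≤m = ⊔-lub (f≤m zero) (max-lub (f≤m ∘ suc))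

foldr-map-allFin : ∀ {n} {A B : Set} (f : A → B → B) z (g : Fin n → A) →
                   List.foldr f z (List.map g (allFin n)) ≡ Vector.foldr f z g
foldr-map-allFin f z g = trans (cong (List.foldr f z) (List.map-tabulate id g)) (foldr-tabulate g)
  where
  foldr-tabulate : ∀ {n} (g : Fin n → _) → List.foldr f z (List.tabulate g) ≡ Vector.foldr f z g
  foldr-tabulate {zero}  g = refl
  foldr-tabulate {suc n} g = cong (f (g zero)) (foldr-tabulate (g ∘ suc))

count≡∣∣ : ∀ {n} (P : Fin n → Bool) → count P ≡ ∣ P ∣
count≡∣∣ P = foldr-map-allFin _+_ 0 (indicator ∘ P)

deg≤Δ : ∀ {n} (G : Graph n) i → deg G i ≤ Δ G
deg≤Δ G i = ≤-trans (≤-max (deg G) i) (≤-reflexive (sym (foldr-map-allFin _⊔_ 0 (deg G))))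

Δ-lub : ∀ {n} (G : Graph n) {m} → (∀ i → deg G i ≤ m) → Δ G ≤ m
Δ-lub G deg≤m = ≤-trans (≤-reflexive (foldr-map-allFin _⊔_ 0 (deg G))) (max-lub deg≤m)

Edge : ℕ → Set
Edge n = Fin n × Fin n

joins : ∀ {n} → Edge n → Fin n → Fin n → Bool
joins (a , b) i j = (⁅ a ⁆ i ∧ ⁅ b ⁆ j) ∨ (⁅ b ⁆ i ∧ ⁅ a ⁆ j)

joins-sym : ∀ {n} (e : Edge n) i j → joins e i j ≡ joins e j i
joins-sym (a , b) i j = trans (Bool.∨-comm (⁅ a ⁆ i ∧ ⁅ b ⁆ j) _)
  (cong₂ _∨_ (Bool.∧-comm (⁅ b ⁆ i) (⁅ a ⁆ j)) (Bool.∧-comm (⁅ a ⁆ i) (⁅ b ⁆ j)))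

joins-fw : ∀ {n} (a b : Fin n) → joins (a , b) a b ≡ true
joins-fw a b rewrite x∈⁅x⁆ a | x∈⁅x⁆ b = refl

joins-bw : ∀ {n} (a b : Fin n) → joins (a , b) b a ≡ true
joins-bw a b = trans (joins-sym (a , b) b a) (joins-fw a b)

joins⁻ : ∀ {n} (a b : Fin n) {i j} → joins (a , b) i j ≡ true → (i ≡ a × j ≡ b) ⊎ (i ≡ b × j ≡ a)
joins⁻ a b {i} {j} h with ∨⁻ (⁅ a ⁆ i ∧ ⁅ b ⁆ j) h
... | inj₁ ab = let i∈⁅a⁆ , j∈⁅b⁆ = ∧⁻ (⁅ a ⁆ i) ab in inj₁ (∈⁅⁆⇒≡ i∈⁅a⁆ , ∈⁅⁆⇒≡ j∈⁅b⁆)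
... | inj₂ ba = let i∈⁅b⁆ , j∈⁅a⁆ = ∧⁻ (⁅ b ⁆ i) ba in inj₂ (∈⁅⁆⇒≡ i∈⁅b⁆ , ∈⁅⁆⇒≡ j∈⁅a⁆)

joins-⊆⁅⁆ : ∀ {n} (e : Edge n) i → ∃ λ x → joins e i ⊆ ⁅ x ⁆
joins-⊆⁅⁆ (a , b) i = case i Fin.≟ a of λ where
  (yes i≡a) → b , λ j h → ≡⇒∈⁅⁆ {x = b} (case joins⁻ a b {i} h of λ where
    (inj₁ (_ , j≡b))   → j≡b
    (inj₂ (i≡b , j≡a)) → trans j≡a (trans (sym i≡a) i≡b))
  (no i≢a)  → a , λ j h → ≡⇒∈⁅⁆ {x = a} (case joins⁻ a b {i} h of λ where
    (inj₁ (i≡a , _))   → contradiction i≡a i≢a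
    (inj₂ (_ , j≡a))   → j≡a)

deleteEdge : ∀ {n} → Edge n → Graph n → Graph n
deleteEdge e G = record
  { adj      = λ i j → adj G i j ∧ not (joins e i j)
  ; sym      = λ i j → cong₂ _∧_ (adj-sym G i j) (cong not (joins-sym e i j))
  ; loopless = λ i → cong (_∧ not (joins e i i)) (loopless G i)
  }

deleteEdges : ∀ {n} → List (Edge n) → Graph n → Graph n
deleteEdges F G = List.foldr deleteEdge G F

Deletes : ∀ {n} → List (Edge n) → Fin n → Fin n → Set
Deletes F i j = Any (λ e → joins e i j ≡ true) F

deleteEdges-⊆ᴱ : ∀ {n} (F : List (Edge n)) G → deleteEdges F G ⊆ᴱ G
deleteEdges-⊆ᴱ []      G i j h = h
deleteEdges-⊆ᴱ (e ∷ F) G i j h = deleteEdges-⊆ᴱ F G i j (proj₁ (∧⁻ (adj (deleteEdges F G) i j) h))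

deleteEdges-deletes : ∀ {n} {F : List (Edge n)} G {i j} →
                      Deletes F i j → adj (deleteEdges F G) i j ≡ false
deleteEdges-deletes {F = e ∷ F} G {i} {j} (here h)  rewrite h =
  Bool.∧-zeroʳ (adj (deleteEdges F G) i j)
deleteEdges-deletes {F = e ∷ F} G {i} {j} (there d) =
  cong (_∧ not (joins e i j)) (deleteEdges-deletes G d)

adj⊆deleteEdge∪joins : ∀ {n} e (G : Graph n) i → adj G i ⊆ adj (deleteEdge e G) i ∪ joins e i
adj⊆deleteEdge∪joins e G i j h with joins e i j in ij∈e
... | true  = ∪⁺ʳ ij∈e
... | false = ∪⁺ˡ (cong₂ _∧_ h (cong not ij∈e))

deg-deleteEdge : ∀ {n} e (G : Graph n) i → deg G i ≤ deg (deleteEdge e G) i + 1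
deg-deleteEdge e G i = begin
  deg G i                                    ≡⟨ count≡∣∣ (adj G i) ⟩
  ∣ adj G i ∣                                ≤⟨ ∣∣-mono (adj⊆deleteEdge∪joins e G i) ⟩
  ∣ adj (deleteEdge e G) i ∪ joins e i ∣     ≤⟨ ∣∪∣≤∣∣+∣∣ _ (joins e i) ⟩
  ∣ adj (deleteEdge e G) i ∣ + ∣ joins e i ∣ ≤⟨ +-monoʳ-≤ _ (⊆⁅⁆⇒∣∣≤1 (proj₂ (joins-⊆⁅⁆ e i))) ⟩
  ∣ adj (deleteEdge e G) i ∣ + 1             ≡⟨ cong (_+ 1) (count≡∣∣ (adj (deleteEdge e G) i)) ⟨
  deg (deleteEdge e G) i + 1                 ∎
  where open ≤-Reasoning

Δ-deleteEdge : ∀ {n} e (G : Graph n) → Δ G ≤ Δ (deleteEdge e G) + 1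
Δ-deleteEdge e G =
  Δ-lub G (λ i → ≤-trans (deg-deleteEdge e G i) (+-monoˡ-≤ 1 (deg≤Δ (deleteEdge e G) i)))

above : ∀ {n} → Fin n → Fin n → Bool
above i j = toℕ i <ᵇ toℕ j

above⇒< : ∀ {n} (i j : Fin n) → above i j ≡ true → toℕ i < toℕ j
above⇒< i j h = <ᵇ⇒< (toℕ i) (toℕ j) (subst T (sym h) tt)

above∩joins⇒ordered : ∀ {n} (a b i j : Fin n) → j ∈ above i ∩ joins (a , b) i →
                      (i , j) ≡ (if above a b then (a , b) else (b , a))
above∩joins⇒ordered a b i j h with ∩⁻ h
... | i<j , ij with above a b in a<b | joins⁻ a b {i} {j} ij
...   | true  | inj₁ (refl , refl) = refl
...   | true  | inj₂ (refl , refl) = contradiction (above⇒< a b a<b) (<⇒≯ (above⇒< b a i<j))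
...   | false | inj₁ (refl , refl) = contradiction (trans (sym i<j) a<b) λ ()
...   | false | inj₂ (refl , refl) = refl

sum∣∣≤1 : ∀ {n} (Q : Fin n → Fin n → Bool) (p : Edge n) → (∀ i j → j ∈ Q i → (i , j) ≡ p) →
          sum (λ i → ∣ Q i ∣) ≤ 1
sum∣∣≤1 Q (x , y) only = ≤-trans (sum-mono-≤ row) (≤-reflexive (∣⁅x⁆∣≡1 x))
  where
  row : ∀ i → ∣ Q i ∣ ≤ indicator (⁅ x ⁆ i)
  row i with ⁅ x ⁆ i in i∈⁅x⁆
  ... | true  = ⊆⁅⁆⇒∣∣≤1 (λ j j∈Q → ≡⇒∈⁅⁆ (cong proj₂ (only i j j∈Q)))
  ... | false = ≤-reflexive (∣∣≡0 λ j → ≢true⇒≡false λ j∈Q →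
                  ≡false⇒≢true i∈⁅x⁆ (≡⇒∈⁅⁆ (cong proj₁ (only i j j∈Q))))

numEdges≡ : ∀ {n} (G : Graph n) → numEdges G ≡ sum (λ i → ∣ above i ∩ adj G i ∣)
numEdges≡ G = trans (foldr-map-allFin _+_ 0 (λ i → count (λ j → above i j ∧ adj G i j)))
  (sum-cong-≗ λ i → trans (count≡∣∣ (λ j → above i j ∧ adj G i j))
                          (∣∣-cong (λ j → sym (∩-∧ (above i) (adj G i) j))))

numEdges-deleteEdge : ∀ {n} (e : Edge n) G → numEdges G ≤ numEdges (deleteEdge e G) + 1
numEdges-deleteEdge (a , b) G = begin
  numEdges G
    ≡⟨ numEdges≡ G ⟩
  sum (λ i → ∣ above i ∩ adj G i ∣)
    ≤⟨ sum-mono-≤ (λ i → ≤-trans (∣∣-mono (split i)) (∣∪∣≤∣∣+∣∣ (above i ∩ adj G′ i) _)) ⟩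
  sum (λ i → ∣ above i ∩ adj G′ i ∣ + ∣ above i ∩ joins (a , b) i ∣)
    ≡⟨ ∑-distrib-+ (λ i → ∣ above i ∩ adj G′ i ∣) _ ⟩
  sum (λ i → ∣ above i ∩ adj G′ i ∣) + sum (λ i → ∣ above i ∩ joins (a , b) i ∣)
    ≤⟨ +-mono-≤ (≤-reflexive (sym (numEdges≡ G′))) (sum∣∣≤1 _ _ (above∩joins⇒ordered a b)) ⟩
  numEdges G′ + 1
    ∎
  where
  open ≤-Reasoning
  G′ : Graph _
  G′ = deleteEdge (a , b) G
  split : ∀ i → above i ∩ adj G i ⊆ (above i ∩ adj G′ i) ∪ (above i ∩ joins (a , b) i)
  split i j h with ∩⁻ h
  ... | i<j , ij with ∪⁻ (adj⊆deleteEdge∪joins (a , b) G i j ij)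
  ...   | inj₁ ij′ = ∪⁺ˡ (∩⁺ i<j ij′)
  ...   | inj₂ ij′ = ∪⁺ʳ (∩⁺ i<j ij′)

numEdges-deleteEdges : ∀ {n} (F : List (Edge n)) G → numEdges G ≤ numEdges (deleteEdges F G) + length F
numEdges-deleteEdges []      G = m≤m+n (numEdges G) 0
numEdges-deleteEdges (e ∷ F) G = begin
  numEdges G                                            ≤⟨ numEdges-deleteEdges F G ⟩
  numEdges (deleteEdges F G) + length F
    ≤⟨ +-monoˡ-≤ (length F) (numEdges-deleteEdge e (deleteEdges F G)) ⟩
  numEdges (deleteEdges (e ∷ F) G) + 1 + length F       ≡⟨ +-assoc _ 1 (length F) ⟩
  numEdges (deleteEdges (e ∷ F) G) + length (e ∷ F)     ∎
  where open ≤-Reasoning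

removed-deleteEdges : ∀ {n} (F : List (Edge n)) G → removed G (deleteEdges F G) ≤ length F
removed-deleteEdges F G =
  m≤n+o⇒m∸n≤o (numEdges G) (numEdges (deleteEdges F G)) (numEdges-deleteEdges F G)

⊆ᴱ⇒deg≤ : ∀ {n} {H G : Graph n} → H ⊆ᴱ G → ∀ i → deg H i ≤ deg G i
⊆ᴱ⇒deg≤ {H = H} {G} H⊆G i =
  subst₂ _≤_ (sym (count≡∣∣ (adj H i))) (sym (count≡∣∣ (adj G i))) (∣∣-mono (H⊆G i))

maxDegree : ∀ {n} → Graph n → Fin n → Bool
maxDegree G i = does (deg G i ≟ Δ G)

maxDegree⇒≡ : ∀ {n} (G : Graph n) {i} → i ∈ maxDegree G → deg G i ≡ Δ G
maxDegree⇒≡ G {i} = does⇒ (deg G i ≟ Δ G)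

∉maxDegree⇒< : ∀ {n} (G : Graph n) {i} → i ∉ maxDegree G → deg G i < Δ G
∉maxDegree⇒< G {i} i∉max = ≤∧≢⇒< (deg≤Δ G i) (¬does⇒ (deg G i ≟ Δ G) i∉max)

Covers : ∀ {n} → Graph n → List (Edge n) → (Fin n → Bool) → Set
Covers G F S = ∀ s → s ∈ S → ∃ λ t → adj G s t ≡ true × Deletes F s t

Covers-⊆ : ∀ {n} {G : Graph n} {F S S′} → S′ ⊆ S → Covers G F S → Covers G F S′
Covers-⊆ S′⊆S covers s s∈S′ = covers s (S′⊆S s s∈S′)

Covers-++ˡ : ∀ {n} {G : Graph n} {F₀} F {S} → Covers G F₀ S → Covers G (F₀ ++ F) S
Covers-++ˡ F covers s s∈S = let t , s~t , deletes = covers s s∈S in t , s~t , Any.++⁺ˡ deletes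

Covers-++ʳ : ∀ {n} {G : Graph n} F₀ {F S} → Covers G F S → Covers G (F₀ ++ F) S
Covers-++ʳ F₀ covers s s∈S = let t , s~t , deletes = covers s s∈S in t , s~t , Any.++⁺ʳ F₀ deletes

Δ-deleteEdges-cover : ∀ {n} (G : Graph n) F → Covers G F (maxDegree G) → Δ (deleteEdges F G) ≤ Δ G ∸ 1
Δ-deleteEdges-cover G F covers = Δ-lub (deleteEdges F G) (λ i → ∸-monoˡ-≤ 1 (deg< i))
  where
  deg< : ∀ i → deg (deleteEdges F G) i < Δ G
  deg< i with ∈-or-∉ (maxDegree G) i
  ... | inj₂ i∉max =
    ≤-<-trans (⊆ᴱ⇒deg≤ {H = deleteEdges F G} {G} (deleteEdges-⊆ᴱ F G) i) (∉maxDegree⇒< G i∉max)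
  ... | inj₁ i∈max = let t , st , deletes = covers i i∈max in begin-strict
    deg (deleteEdges F G) i      ≡⟨ count≡∣∣ (adj (deleteEdges F G) i) ⟩
    ∣ adj (deleteEdges F G) i ∣  <⟨ ⊂⇒∣∣<∣∣ (deleteEdges-⊆ᴱ F G i) (deleteEdges-deletes G deletes) st ⟩
    ∣ adj G i ∣                  ≡⟨ count≡∣∣ (adj G i) ⟨
    deg G i                      ≡⟨ maxDegree⇒≡ G i∈max ⟩
    Δ G                          ∎
    where open ≤-Reasoning

Δ-deleteEdges-exact : ∀ {n} (G : Graph n) F → 1 ≤ Δ G → Δ (deleteEdges F G) ≤ Δ G ∸ 1 →
                      ∃ λ F′ → Δ (deleteEdges F′ G) ≡ Δ G ∸ 1 × length F′ ≤ length F
Δ-deleteEdges-exact G []      1≤Δ     Δ≤Δ∸1  = contradiction Δ≤Δ∸1 (<⇒≱ (∸-monoʳ-< z<s 1≤Δ))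
Δ-deleteEdges-exact G (e ∷ F) 1≤Δ     Δ′≤Δ∸1 with Δ (deleteEdges F G) ≤? Δ G ∸ 1
... | yes Δ″≤Δ∸1 = let F′ , Δ≡ , len≤ = Δ-deleteEdges-exact G F 1≤Δ Δ″≤Δ∸1 in F′ , Δ≡ , m≤n⇒m≤1+n len≤
... | no  Δ″≰Δ∸1 = e ∷ F , ≤-antisym Δ′≤Δ∸1 Δ∸1≤Δ′ , ≤-refl
  where
  Δ∸1≤Δ′ : Δ G ∸ 1 ≤ Δ (deleteEdges (e ∷ F) G)
  Δ∸1≤Δ′ = ≤-pred (≤-trans (≰⇒> Δ″≰Δ∸1)
             (≤-trans (Δ-deleteEdge e (deleteEdges F G)) (≤-reflexive (+-comm _ 1))))

Δ-removal-of-cover : ∀ {n} (G : Graph n) F → 1 ≤ Δ G → Covers G F (maxDegree G) →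
                     Σ (Graph n) λ H → IsΔRemoval G H × removed G H ≤ length F
Δ-removal-of-cover G F 1≤Δ covers =
  let F′ , Δ≡ , len≤ = Δ-deleteEdges-exact G F 1≤Δ (Δ-deleteEdges-cover G F covers)
  in  deleteEdges F′ G , (deleteEdges-⊆ᴱ F′ G , Δ≡) , ≤-trans (removed-deleteEdges F′ G) len≤

-- Hall's theorem

-- E is read as a bipartite graph between two copies of Fin n.
module Hall {n : ℕ} (E : Fin n → Fin n → Bool) where

  N : (Fin n → Bool) → Fin n → Bool
  N X w = any (λ x → X x ∧ E x w)

  N-intro : ∀ {X x w} → x ∈ X → E x w ≡ true → w ∈ N X
  N-intro {X} {x} {w} x∈X e = any-intro {P = λ x → X x ∧ E x w} (trans (cong (_∧ E x w) x∈X) e)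

  N-witness : ∀ {X w} → w ∈ N X → ∃ λ x → x ∈ X × E x w ≡ true
  N-witness {X} h = let x , x∈ = any-witness h in x , ∧⁻ (X x) x∈

  N-mono : ∀ {X Y} → X ⊆ Y → N X ⊆ N Y
  N-mono X⊆Y w h = let x , x∈X , e = N-witness h in N-intro (X⊆Y x x∈X) e

  N-∪ : ∀ {X Y} → N (X ∪ Y) ⊆ N X ∪ N Y
  N-∪ {X} {Y} w h with N-witness {X ∪ Y} h
  ... | x , x∈X∪Y , e with ∪⁻ x∈X∪Y
  ...   | inj₁ x∈X = ∪⁺ˡ (N-intro x∈X e)
  ...   | inj₂ x∈Y = ∪⁺ʳ (N-intro x∈Y e)

  N-cong : ∀ {X Y} → (∀ i → X i ≡ Y i) → ∀ w → N X w ≡ N Y w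
  N-cong X≗Y w = any-cong (λ x → cong (_∧ E x w) (X≗Y x))

  HallCondition : (L R : Fin n → Bool) → Set
  HallCondition L R = ∀ X → X ⊆ L → ∣ X ∣ ≤ ∣ R ∩ N X ∣

  record IsMatching (L R : Fin n → Bool) (f : Fin n → Fin n) : Set where
    field
      edge      : ∀ x → x ∈ L → E x (f x) ≡ true
      into      : ∀ x → x ∈ L → f x ∈ R
      injective : ∀ x y → x ∈ L → y ∈ L → f x ≡ f y → x ≡ y

  combine-matchings : ∀ {P L R R₁ R₂ f₁ f₂} → R₁ ⊆ R → R₂ ⊆ R → (∀ y → y ∈ R₁ → y ∉ R₂) →
                      IsMatching P R₁ f₁ → IsMatching (L ─ P) R₂ f₂ →
                      IsMatching L R (λ x → if P x then f₁ x else f₂ x)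
  combine-matchings {P} {L} {R} {R₁} {R₂} {f₁} {f₂} R₁⊆R R₂⊆R disjoint m₁ m₂ = record
    { edge = edge ; into = into ; injective = injective }
    where
    module M₁ = IsMatching m₁
    module M₂ = IsMatching m₂

    edge : ∀ x → x ∈ L → E x (if P x then f₁ x else f₂ x) ≡ true
    edge x x∈L with P x in x∈P
    ... | true  = M₁.edge x x∈P
    ... | false = M₂.edge x (─⁺ x∈L x∈P)

    into : ∀ x → x ∈ L → (if P x then f₁ x else f₂ x) ∈ R
    into x x∈L with P x in x∈P
    ... | true  = R₁⊆R (f₁ x) (M₁.into x x∈P)
    ... | false = R₂⊆R (f₂ x) (M₂.into x (─⁺ x∈L x∈P))

    separated : ∀ {x y} → x ∈ P → y ∈ L ─ P → f₁ x ≢ f₂ y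
    separated {x} {y} x∈P y∈L─P f₁x≡f₂y =
      ≡false⇒≢true (disjoint (f₁ x) (M₁.into x x∈P)) (subst (_∈ R₂) (sym f₁x≡f₂y) (M₂.into y y∈L─P))

    injective : ∀ x y → x ∈ L → y ∈ L →
                (if P x then f₁ x else f₂ x) ≡ (if P y then f₁ y else f₂ y) → x ≡ y
    injective x y x∈L y∈L eq with P x in x∈P | P y in y∈P
    ... | true  | true  = M₁.injective x y x∈P y∈P eq
    ... | false | false = M₂.injective x y (─⁺ x∈L x∈P) (─⁺ y∈L y∈P) eq
    ... | true  | false = contradiction eq (separated x∈P (─⁺ y∈L y∈P))
    ... | false | true  = contradiction (sym eq) (separated y∈P (─⁺ x∈L x∈P))

  HallCondition⇒neighbour : ∀ {L R x} → HallCondition L R → x ∈ L → ∃ λ y → y ∈ R × E x y ≡ true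
  HallCondition⇒neighbour {L} {R} {x} hc x∈L =
    let y , y∈ = 1≤∣∣⇒∈ (≤-trans (1≤∣⁅x⁆∣ x) (hc ⁅ x ⁆ (∈⇒⁅⁆⊆ x∈L)))
        y∈R , y∈N⁅x⁆ = ∩⁻ y∈
        x′ , x′∈⁅x⁆ , e = N-witness y∈N⁅x⁆
    in  y , y∈R , subst (λ z → E z y ≡ true) (∈⁅⁆⇒≡ x′∈⁅x⁆) e

  Tight : (L R X : Fin n → Bool) → Set
  Tight L R X = X ⊆ L × 1 ≤ ∣ X ∣ × ∣ X ∣ < ∣ L ∣ × ∣ R ∩ N X ∣ ≤ ∣ X ∣

  Tight-cong : ∀ {L R X Y} → (∀ i → X i ≡ Y i) → Tight L R X → Tight L R Y
  Tight-cong {L} {R} {X} {Y} X≗Y (X⊆L , 1≤∣X∣ , ∣X∣<∣L∣ , ∣NX∣≤∣X∣) =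
      (λ i i∈Y → X⊆L i (trans (X≗Y i) i∈Y))
    , subst (1 ≤_) ∣X∣≡∣Y∣ 1≤∣X∣
    , subst (_< ∣ L ∣) ∣X∣≡∣Y∣ ∣X∣<∣L∣
    , subst₂ _≤_ (∣∣-cong R∩NX≗R∩NY) ∣X∣≡∣Y∣ ∣NX∣≤∣X∣
    where
    ∣X∣≡∣Y∣ : ∣ X ∣ ≡ ∣ Y ∣
    ∣X∣≡∣Y∣ = ∣∣-cong X≗Y
    R∩NX≗R∩NY : ∀ w → (R ∩ N X) w ≡ (R ∩ N Y) w
    R∩NX≗R∩NY w = trans (∩-∧ R (N X) w) (trans (cong (R w ∧_) (N-cong X≗Y w)) (sym (∩-∧ R (N Y) w)))

  tight? : ∀ L R → Dec (∃ (Tight L R))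
  tight? L R with anySubset? (λ v → Tight? (Vec.lookup v))
    where
    Tight? : ∀ X → Dec (Tight L R X)
    Tight? X = ⊆? X L ×-dec 1 ≤? ∣ X ∣ ×-dec ∣ X ∣ <? ∣ L ∣ ×-dec ∣ R ∩ N X ∣ ≤? ∣ X ∣
  ... | yes (v , tight) = yes (Vec.lookup v , tight)
  ... | no  ∄tight      = no λ (X , tight) →
    ∄tight (Vec.tabulate X , Tight-cong (λ i → sym (Vec.lookup∘tabulate X i)) tight)

  HallCondition-remove : ∀ {L R x y} → HallCondition L R → ¬ ∃ (Tight L R) → x ∈ L →
                HallCondition (L ─ ⁅ x ⁆) (R ─ ⁅ y ⁆)
  HallCondition-remove {L} {R} {x} {y} hc ∄tight x∈L X X⊆L′ with 1 ≤? ∣ X ∣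
  ... | no  ∣X∣≱1 = ≤-trans (≤-pred (≰⇒> ∣X∣≱1)) z≤n
  ... | yes 1≤∣X∣ = ≤-pred (begin
    suc ∣ X ∣                    ≤⟨ ≰⇒> (λ ∣NX∣≤∣X∣ → ∄tight (X , X⊆L , 1≤∣X∣ , ∣X∣<∣L∣ , ∣NX∣≤∣X∣)) ⟩
    ∣ R ∩ N X ∣                  ≤⟨ ∣∣-mono R∩NX⊆ ⟩
    ∣ (R ─ ⁅ y ⁆) ∩ N X ∪ ⁅ y ⁆ ∣ ≤⟨ ∣∪∣≤∣∣+∣∣ ((R ─ ⁅ y ⁆) ∩ N X) ⁅ y ⁆ ⟩
    ∣ (R ─ ⁅ y ⁆) ∩ N X ∣ + ∣ ⁅ y ⁆ ∣ ≡⟨ cong₂ _+_ refl (∣⁅x⁆∣≡1 y) ⟩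
    ∣ (R ─ ⁅ y ⁆) ∩ N X ∣ + 1    ≡⟨ +-comm _ 1 ⟩
    suc ∣ (R ─ ⁅ y ⁆) ∩ N X ∣    ∎)
    where
    open ≤-Reasoning
    X⊆L : X ⊆ L
    X⊆L i i∈X = proj₁ (─⁻ (X⊆L′ i i∈X))
    ∣X∣<∣L∣ : ∣ X ∣ < ∣ L ∣
    ∣X∣<∣L∣ = ≤-<-trans (∣∣-mono X⊆L′)
                (∣─∣<∣∣ {P = L} (∈⇒⁅⁆⊆ x∈L) (1≤∣⁅x⁆∣ x))
    R∩NX⊆ : R ∩ N X ⊆ (R ─ ⁅ y ⁆) ∩ N X ∪ ⁅ y ⁆
    R∩NX⊆ w w∈ with ∈-or-∉ ⁅ y ⁆ w | ∩⁻ w∈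
    ... | inj₁ w∈⁅y⁆ | _           = ∪⁺ʳ w∈⁅y⁆
    ... | inj₂ w∉⁅y⁆ | w∈R , w∈NX = ∪⁺ˡ (∩⁺ (─⁺ w∈R w∉⁅y⁆) w∈NX)

  HallCondition-sub : ∀ {L R X₀} → HallCondition L R → X₀ ⊆ L → HallCondition X₀ (R ∩ N X₀)
  HallCondition-sub {L} {R} {X₀} hc X₀⊆L X X⊆X₀ =
    ≤-trans (hc X (λ i → X₀⊆L i ∘ X⊆X₀ i)) (∣∣-mono R∩NX⊆)
    where
    R∩NX⊆ : R ∩ N X ⊆ (R ∩ N X₀) ∩ N X
    R∩NX⊆ w w∈ = let w∈R , w∈NX = ∩⁻ w∈ in ∩⁺ (∩⁺ w∈R (N-mono X⊆X₀ w w∈NX)) w∈NX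

  HallCondition-complement : ∀ {L R X₀} → HallCondition L R → X₀ ⊆ L → ∣ R ∩ N X₀ ∣ ≤ ∣ X₀ ∣ →
                 HallCondition (L ─ X₀) (R ─ N X₀)
  HallCondition-complement {L} {R} {X₀} hc X₀⊆L tight Y Y⊆L─X₀ = +-cancelʳ-≤ ∣ X₀ ∣ ∣ Y ∣ _ (begin
    ∣ Y ∣ + ∣ X₀ ∣                            ≤⟨ disjoint⇒∣∣+∣∣≤∣∪∣ (λ i → proj₂ ∘ ─⁻ ∘ Y⊆L─X₀ i) ⟩
    ∣ Y ∪ X₀ ∣                                ≤⟨ hc (Y ∪ X₀) Y∪X₀⊆L ⟩
    ∣ R ∩ N (Y ∪ X₀) ∣                        ≤⟨ ∣∣-mono R∩N⊆ ⟩
    ∣ (R ─ N X₀) ∩ N Y ∪ R ∩ N X₀ ∣           ≤⟨ ∣∪∣≤∣∣+∣∣ ((R ─ N X₀) ∩ N Y) (R ∩ N X₀) ⟩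
    ∣ (R ─ N X₀) ∩ N Y ∣ + ∣ R ∩ N X₀ ∣       ≤⟨ +-monoʳ-≤ ∣ (R ─ N X₀) ∩ N Y ∣ tight ⟩
    ∣ (R ─ N X₀) ∩ N Y ∣ + ∣ X₀ ∣             ∎)
    where
    open ≤-Reasoning
    Y∪X₀⊆L : Y ∪ X₀ ⊆ L
    Y∪X₀⊆L i i∈ with ∪⁻ i∈
    ... | inj₁ i∈Y  = proj₁ (─⁻ (Y⊆L─X₀ i i∈Y))
    ... | inj₂ i∈X₀ = X₀⊆L i i∈X₀
    R∩N⊆ : R ∩ N (Y ∪ X₀) ⊆ (R ─ N X₀) ∩ N Y ∪ R ∩ N X₀
    R∩N⊆ w w∈ with ∩⁻ w∈
    ... | w∈R , w∈N with ∈-or-∉ (N X₀) w | ∪⁻ (N-∪ w w∈N)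
    ...   | inj₁ w∈NX₀ | _          = ∪⁺ʳ (∩⁺ w∈R w∈NX₀)
    ...   | inj₂ w∉NX₀ | inj₁ w∈NY  = ∪⁺ˡ (∩⁺ (─⁺ w∈R w∉NX₀) w∈NY)
    ...   | inj₂ w∉NX₀ | inj₂ w∈NX₀ = contradiction w∈NX₀ (≡false⇒≢true w∉NX₀)

  empty-matching : ∀ {L R} f → ¬ 1 ≤ ∣ L ∣ → IsMatching L R f
  empty-matching {L} f ∣L∣≱1 = record
    { edge      = λ x x∈L → absurd x∈L
    ; into      = λ x x∈L → absurd x∈L
    ; injective = λ x _ x∈L _ _ → absurd x∈L
    }
    where
    absurd : ∀ {x} {A : Set} → x ∈ L → A
    absurd x∈L = contradiction (∈⇒1≤∣∣ {P = L} x∈L) ∣L∣≱1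

  single-matching : ∀ {x y} → E x y ≡ true → IsMatching ⁅ x ⁆ ⁅ y ⁆ (λ _ → y)
  single-matching {x} {y} e = record
    { edge      = λ x′ x′∈⁅x⁆ → subst (λ z → E z y ≡ true) (sym (∈⁅⁆⇒≡ x′∈⁅x⁆)) e
    ; into      = λ _ _ → x∈⁅x⁆ y
    ; injective = λ x₁ x₂ x₁∈⁅x⁆ x₂∈⁅x⁆ _ → trans (∈⁅⁆⇒≡ x₁∈⁅x⁆) (sym (∈⁅⁆⇒≡ x₂∈⁅x⁆))
    }

  -- Either some nonempty proper X ⊆ L is tight, and X is matched into N X independently of the
  -- rest, or every such X has a surplus neighbour, and any edge x y can be matched first.
  hall-bounded : ∀ m {L R} → ∣ L ∣ ≤ m → HallCondition L R → ∃ (IsMatching L R)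
  hall-bounded zero ∣L∣≤0 hc =
    id , empty-matching id (λ 1≤∣L∣ → contradiction (≤-trans 1≤∣L∣ ∣L∣≤0) λ ())
  hall-bounded (suc m) {L} {R} ∣L∣≤1+m hc with 1 ≤? ∣ L ∣ | tight? L R
  ... | no ∣L∣≱1  | _ = id , empty-matching id ∣L∣≱1
  ... | yes _     | yes (X , X⊆L , 1≤∣X∣ , ∣X∣<∣L∣ , ∣NX∣≤∣X∣) =
    let f₁ , m₁ = hall-bounded m {X} {R ∩ N X} (≤-pred (≤-trans ∣X∣<∣L∣ ∣L∣≤1+m))
                               (HallCondition-sub hc X⊆L)
        f₂ , m₂ = hall-bounded m {L ─ X} {R ─ N X} (∣─∣≤pred X⊆L 1≤∣X∣ ∣L∣≤1+m)
                               (HallCondition-complement hc X⊆L ∣NX∣≤∣X∣)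
    in  _ , combine-matchings (λ w → proj₁ ∘ ∩⁻) (λ w → proj₁ ∘ ─⁻) (λ w → ∈⇒∉─ ∘ proj₂ ∘ ∩⁻) m₁ m₂
  ... | yes 1≤∣L∣ | no ∄tight =
    let x , x∈L     = 1≤∣∣⇒∈ 1≤∣L∣
        y , y∈R , e = HallCondition⇒neighbour hc x∈L
        f , m′      = hall-bounded m {L ─ ⁅ x ⁆} {R ─ ⁅ y ⁆}
                        (∣─∣≤pred {P = L} (∈⇒⁅⁆⊆ x∈L) (1≤∣⁅x⁆∣ x) ∣L∣≤1+m)
                        (HallCondition-remove hc ∄tight x∈L)
    in  _ , combine-matchings (∈⇒⁅⁆⊆ y∈R) (λ w → proj₁ ∘ ─⁻) (λ w → ∈⇒∉─) (single-matching e) m′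

  hall : ∀ {L R} → HallCondition L R → ∃ (IsMatching L R)
  hall {L} = hall-bounded ∣ L ∣ ≤-refl

  degrees⇒HallCondition : ∀ {L} d → 1 ≤ d →
                          (∀ x → x ∈ L → d ≤ ∣ E x ∣) → (∀ w → ∣ (λ x → E x w) ∣ ≤ d) →
                          HallCondition L full
  degrees⇒HallCondition {L} d 1≤d d≤deg deg≤d X X⊆L = *-cancelˡ-≤ d {{>-nonZero 1≤d}} (begin
    d * ∣ X ∣                             ≡⟨ *-distribˡ-sum d (indicator ∘ X) ⟩
    sum (λ x → d * indicator (X x))       ≤⟨ sum-mono-≤ row ⟩
    sum (λ x → ∣ (λ w → X x ∧ E x w) ∣)   ≡⟨ ∑-comm (λ x w → indicator (X x ∧ E x w)) ⟩
    sum (λ w → ∣ (λ x → X x ∧ E x w) ∣)   ≤⟨ sum-mono-≤ column ⟩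
    sum (λ w → d * indicator (N X w))     ≡⟨ *-distribˡ-sum d (indicator ∘ N X) ⟨
    d * ∣ N X ∣                           ≡⟨ cong (d *_) (∣∣-cong (∩-∧ full (N X))) ⟨
    d * ∣ full ∩ N X ∣                    ∎)
    where
    open ≤-Reasoning
    row : ∀ x → d * indicator (X x) ≤ ∣ (λ w → X x ∧ E x w) ∣
    row x with X x in x∈X
    ... | true  = ≤-trans (≤-reflexive (*-identityʳ d)) (d≤deg x (X⊆L x x∈X))
    ... | false = ≤-trans (≤-reflexive (*-zeroʳ d)) z≤n
    column : ∀ w → ∣ (λ x → X x ∧ E x w) ∣ ≤ d * indicator (N X w)
    column w with N X w in w∈NX
    ... | true  =
      ≤-trans (∣∣-mono (λ x → proj₂ ∘ ∧⁻ (X x))) (≤-trans (deg≤d w) (≤-reflexive (sym (*-identityʳ d))))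
    ... | false = ≤-trans (≤-reflexive (∣∣≡0 {P = λ x → X x ∧ E x w} λ x → ≢true⇒≡false λ h →
                    ≡false⇒≢true w∈NX (any-intro {P = λ x → X x ∧ E x w} h))) z≤n

-- Periodic sequences and closed walks

least : ∀ {P : ℕ → Set} → Decidable P → ∀ {m} → P m → ∃ λ l → P l × (∀ {j} → j < l → ¬ P j)
least {P} P? {m} = <-rec (λ m → P m → ∃ λ l → P l × (∀ {j} → j < l → ¬ P j)) step m
  where
  step : ∀ m → (∀ {j} → j < m → P j → ∃ λ l → P l × (∀ {i} → i < l → ¬ P i)) →
         P m → ∃ λ l → P l × (∀ {j} → j < l → ¬ P j)
  step m smaller Pm with anyUpTo? P? m
  ... | yes (j , j<m , Pj) = smaller j<m Pj
  ... | no  ∄j             = m , Pm , λ j<m Pj → ∄j (_ , j<m , Pj)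

i+suc[j∸suc[i]]≡j : ∀ {i j} → i < j → i + suc (j ∸ suc i) ≡ j
i+suc[j∸suc[i]]≡j {i} i<j = trans (+-suc i _) (m+[n∸m]≡n i<j)

module Periodic {n : ℕ} (c : ℕ → Fin n) (h : Fin n → Fin n) (back : ∀ i → h (c (suc i)) ≡ c i) where

  shift : ∀ i d → c i ≡ c (i + d) → c 0 ≡ c d
  shift zero    d eq = eq
  shift (suc i) d eq = shift i d (trans (sym (back i)) (trans (cong h eq) (back (i + d))))

  returns : ∃ λ d → c (suc d) ≡ c 0
  returns with Fin.pigeonhole (n<1+n n) (c ∘ toℕ)
  ... | i , j , i<j , ci≡cj =
    _ , sym (shift (toℕ i) _ (trans ci≡cj (cong c (sym (i+suc[j∸suc[i]]≡j i<j)))))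

  period : ∃ λ L → c (suc L) ≡ c 0 × (∀ {i j} → i < j → j ≤ L → c i ≢ c j)
  period with least (λ L → c (suc L) Fin.≟ c 0) (proj₂ returns)
  ... | L , closes , minimal = L , closes , distinct
    where
    distinct : ∀ {i j} → i < j → j ≤ L → c i ≢ c j
    distinct {i} {j} i<j j≤L ci≡cj =
      minimal (≤-trans (≤-reflexive (sym (+-∸-assoc 1 i<j))) (≤-trans (m∸n≤m j i) j≤L))
              (sym (shift i _ (trans ci≡cj (cong c (sym (i+suc[j∸suc[i]]≡j i<j))))))

toℕ-next : ∀ {L} (i : Fin (suc L)) →
           toℕ i < L × toℕ (next i) ≡ suc (toℕ i) ⊎ toℕ i ≡ L × toℕ (next i) ≡ 0
toℕ-next {L} i with m≤n⇒m<n∨m≡n (≤-pred (Fin.toℕ<n i))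
... | inj₁ i<L = inj₁ (i<L , trans (Fin.toℕ-fromℕ< _) (m≤n⇒m%n≡m i<L))
... | inj₂ i≡L =
  inj₂ (i≡L , trans (Fin.toℕ-fromℕ< _) (trans (cong (λ m → suc m % suc L) i≡L) (n%n≡0 (suc L))))

module ClosedWalk {n} (G : Graph n) (c : ℕ → Fin n) (L : ℕ)
                  (walk : ∀ i → adj G (c i) (c (suc i)) ≡ true) (closes : c (suc L) ≡ c 0)
                  (distinct : ∀ {i j} → i < j → j ≤ L → c i ≢ c j) where

  cycle : Fin (suc L) → Fin n
  cycle i = c (toℕ i)

  c-suc≡cycle-next : ∀ i → c (suc (toℕ i)) ≡ cycle (next i)
  c-suc≡cycle-next i with toℕ-next i
  ... | inj₁ (_ , next≡suc)  = cong c (sym next≡suc)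
  ... | inj₂ (i≡L , next≡0) = trans (cong (c ∘ suc) i≡L) (trans closes (cong c (sym next≡0)))

  cycle-injective : Injective _≡_ _≡_ cycle
  cycle-injective {i} {j} eq with <-cmp (toℕ i) (toℕ j)
  ... | tri< i<j _ _ = contradiction eq (distinct i<j (≤-pred (Fin.toℕ<n j)))
  ... | tri≈ _ i≡j _ = Fin.toℕ-injective i≡j
  ... | tri> _ _ j<i = contradiction (sym eq) (distinct j<i (≤-pred (Fin.toℕ<n i)))

  nontrivial : L ≢ 0
  nontrivial refl =
    ≡false⇒≢true (loopless G (c 0)) (subst (λ u → adj G (c 0) u ≡ true) closes (walk 0))

  is-cycle : 3 ≤ suc L → IsCycle G L cycle
  is-cycle 3≤ = 3≤ , cycle-injective ,
    λ i → subst (λ u → adj G (cycle i) u ≡ true) (c-suc≡cycle-next i) (walk (toℕ i))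

parity : ∀ p → (∃ λ t → p ≡ 2 * t) ⊎ Odd p
parity zero    = inj₁ (0 , refl)
parity (suc p) with parity p
... | inj₁ (t , p≡2t)   = inj₂ (t , cong suc p≡2t)
... | inj₂ (t , p≡1+2t) = inj₁ (suc t , trans (cong suc p≡1+2t) (sym (*-suc 2 t)))

module _ where
  open +-*-Solver

  half-cost-even : ∀ k t → (2 * k + 1) * t ≤ (k + 1) * (2 * t)
  half-cost-even k t = ≤-trans (m≤m+n _ t) (≤-reflexive
    (solve 2 (λ k t → (con 2 :* k :+ con 1) :* t :+ t := (k :+ con 1) :* (con 2 :* t)) refl k t))

  half-cost-odd : ∀ k t → k ≤ t → (2 * k + 1) * suc t ≤ (k + 1) * suc (2 * t)
  half-cost-odd k t k≤t with t ∸ k | m+[n∸m]≡n k≤t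
  ... | d | refl = ≤-trans (m≤m+n _ d) (≤-reflexive
    (solve 2 (λ k d → (con 2 :* k :+ con 1) :* (con 1 :+ (k :+ d)) :+ d
                   := (k :+ con 1) :* (con 1 :+ con 2 :* (k :+ d))) refl k d))

cycle-cost : ∀ k p → (Odd p → 2 * k + 1 ≤ p) → ∃ λ q → p ≤ 2 * q × (2 * k + 1) * q ≤ (k + 1) * p
cycle-cost k p odd⇒long with parity p
... | inj₁ (t , refl) = t , ≤-refl , half-cost-even k t
... | inj₂ (t , refl) =
  suc t , ≤-trans (n≤1+n _) (≤-reflexive (sym (*-suc 2 t))) , half-cost-odd k t k≤t
  where
  k≤t : k ≤ t
  k≤t = *-cancelˡ-≤ 2 (≤-pred (subst (_≤ suc (2 * t)) (+-comm (2 * k) 1) (odd⇒long (t , refl))))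

pairs : ∀ {n} → (ℕ → Fin n) → ℕ → List (Edge n)
pairs c zero    = []
pairs c (suc q) = (c (2 * q) , c (suc (2 * q))) ∷ pairs c q

length-pairs : ∀ {n} (c : ℕ → Fin n) q → length (pairs c q) ≡ q
length-pairs c zero    = refl
length-pairs c (suc q) = cong suc (length-pairs c q)

pairs-cover : ∀ {n} (G : Graph n) (c : ℕ → Fin n) → (∀ i → adj G (c i) (c (suc i)) ≡ true) →
              ∀ q {i} → i < 2 * q → ∃ λ t → adj G (c i) t ≡ true × Deletes (pairs c q) (c i) t
pairs-cover G c walk (suc q) {i} i<2+2q with m≤n⇒m<n∨m≡n (≤-pred (subst (i <_) (*-suc 2 q) i<2+2q))
... | inj₂ refl = c (2 * q) , trans (adj-sym G _ _) (walk (2 * q)) , here (joins-bw _ _)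
... | inj₁ i<1+2q with m≤n⇒m<n∨m≡n (≤-pred i<1+2q)
...   | inj₂ refl = c (suc (2 * q)) , walk (2 * q) , here (joins-fw _ _)
...   | inj₁ i<2q = let t , ci~t , deletes = pairs-cover G c walk q i<2q in t , ci~t , there deletes

range : ∀ {m n} → (Fin m → Fin n) → Fin n → Bool
range g u = any (λ i → ⁅ u ⁆ (g i))

range-intro : ∀ {m n} (g : Fin m → Fin n) i → g i ∈ range g
range-intro g i = any-intro {P = λ j → ⁅ g i ⁆ (g j)} (x∈⁅x⁆ (g i))

range-witness : ∀ {m n} {g : Fin m → Fin n} {u} → u ∈ range g → ∃ λ i → g i ≡ u
range-witness {g = g} {u} h =
  let i , gi∈⁅u⁆ = any-witness {P = λ j → ⁅ u ⁆ (g j)} h in i , ∈⁅⁆⇒≡ gi∈⁅u⁆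

≤∣range∣ : ∀ {m n} {g : Fin m → Fin n} → Injective _≡_ _≡_ g → m ≤ ∣ range g ∣
≤∣range∣ {zero}          _      = z≤n
≤∣range∣ {suc m} {g = g} g-inj =
  ≤-trans (s≤s (≤∣range∣ {g = g ∘ suc} (λ e → Fin.suc-injective (g-inj e))))
          (⊂⇒∣∣<∣∣ range-suc⊆ g0∉range-suc (range-intro g zero))
  where
  range-suc⊆ : range (g ∘ suc) ⊆ range g
  range-suc⊆ u h = let i , gi≡u = range-witness h in subst (_∈ range g) gi≡u (range-intro g (suc i))
  g0∉range-suc : g zero ∉ range (g ∘ suc)
  g0∉range-suc = ≢true⇒≡false λ h →
    let i , gi≡g0 = range-witness {g = g ∘ suc} h in case g-inj {suc i} {zero} gi≡g0 of λ ()

-- Covering the vertices of maximum degree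

module Cover {n} (G : Graph n) (S : Fin n → Bool) (f : Fin n → Fin n)
             (matching : Hall.IsMatching (adj G) S full f) (k : ℕ)
             (girth : ∀ m → Odd m → HasCycleOfLength G m → 2 * k + 1 ≤ m) where

  open Hall.IsMatching matching using (injective) renaming (edge to s~fs)

  Closed : (Fin n → Bool) → Set
  Closed A = ∀ s → s ∈ S → s ∈ A → f s ∈ A

  image : (Fin n → Bool) → Fin n → Bool
  image A u = any (λ s → (S ∩ A) s ∧ ⁅ u ⁆ (f s))

  image-intro : ∀ {A s} → s ∈ S → s ∈ A → f s ∈ image A
  image-intro {A} {s} s∈S s∈A = any-intro {P = λ s′ → (S ∩ A) s′ ∧ ⁅ f s ⁆ (f s′)}
    (trans (cong (_∧ ⁅ f s ⁆ (f s)) (∩⁺ s∈S s∈A)) (x∈⁅x⁆ (f s)))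

  image-witness : ∀ {A u} → u ∈ image A → ∃ λ s → s ∈ S × s ∈ A × f s ≡ u
  image-witness {A} {u} h =
    let s , s∈ = any-witness {P = λ s → (S ∩ A) s ∧ ⁅ u ⁆ (f s)} h
        s∈S∩A , fs∈⁅u⁆ = ∧⁻ ((S ∩ A) s) s∈
    in  s , proj₁ (∩⁻ s∈S∩A) , proj₂ (∩⁻ s∈S∩A) , ∈⁅⁆⇒≡ fs∈⁅u⁆

  record Piece (A : Fin n → Bool) : Set where
    field
      part     : Fin n → Bool
      edges    : List (Edge n)
      part⊆A   : part ⊆ A
      nonempty : 1 ≤ ∣ part ∣
      preimage-closed : ∀ s → s ∈ S → s ∈ A → f s ∈ part → s ∈ part
      covers   : Covers G edges (S ∩ part)
      cost     : (2 * k + 1) * length edges ≤ (k + 1) * ∣ part ∣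

  rest-closed : ∀ {A} → Closed A → (P : Piece A) → Closed (A ─ Piece.part P)
  rest-closed closed P s s∈S s∈A─B =
    let s∈A , s∉B = ─⁻ s∈A─B
    in  ─⁺ (closed s s∈S s∈A)
           (≢true⇒≡false λ fs∈B → ≡false⇒≢true s∉B (Piece.preimage-closed P s s∈S s∈A fs∈B))

  singleton-piece : ∀ {A u} → u ∈ A → u ∉ image A → u ∉ S → Piece A
  singleton-piece {A} {u} u∈A u∉img u∉S = record
    { part            = ⁅ u ⁆
    ; edges           = []
    ; part⊆A          = ∈⇒⁅⁆⊆ u∈A
    ; nonempty        = 1≤∣⁅x⁆∣ u
    ; preimage-closed = λ s s∈S s∈A fs∈⁅u⁆ →
        contradiction (subst (_∈ image A) (∈⁅⁆⇒≡ fs∈⁅u⁆) (image-intro s∈S s∈A)) (≡false⇒≢true u∉img)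
    ; covers          = λ s s∈ → let s∈S , s∈⁅u⁆ = ∩⁻ s∈ in
        contradiction (subst (_∈ S) (∈⁅⁆⇒≡ s∈⁅u⁆) s∈S) (≡false⇒≢true u∉S)
    ; cost            = ≤-trans (≤-reflexive (*-zeroʳ (2 * k + 1))) z≤n
    }

  edge-piece : ∀ {A u} → Closed A → u ∈ A → u ∉ image A → u ∈ S → Piece A
  edge-piece {A} {u} closed u∈A u∉img u∈S = record
    { part            = ⁅ u ⁆ ∪ ⁅ f u ⁆
    ; edges           = (u , f u) ∷ []
    ; part⊆A          = part⊆A
    ; nonempty        = ∈⇒1≤∣∣ {P = ⁅ u ⁆ ∪ ⁅ f u ⁆} (∪⁺ˡ (x∈⁅x⁆ u))
    ; preimage-closed = preimage-closed
    ; covers          = covers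
    ; cost            = ≤-trans (half-cost-even k 1) (*-monoʳ-≤ (k + 1) 2≤∣part∣)
    }
    where
    part⊆A : ⁅ u ⁆ ∪ ⁅ f u ⁆ ⊆ A
    part⊆A i i∈ with ∪⁻ i∈
    ... | inj₁ i∈⁅u⁆  = ∈⇒⁅⁆⊆ u∈A i i∈⁅u⁆
    ... | inj₂ i∈⁅fu⁆ = ∈⇒⁅⁆⊆ (closed u u∈S u∈A) i i∈⁅fu⁆

    u≢fu : u ≢ f u
    u≢fu u≡fu = ≡false⇒≢true (loopless G u) (subst (λ v → adj G u v ≡ true) (sym u≡fu) (s~fs u u∈S))

    2≤∣part∣ : 2 ≤ ∣ ⁅ u ⁆ ∪ ⁅ f u ⁆ ∣
    2≤∣part∣ = subst (_< ∣ ⁅ u ⁆ ∪ ⁅ f u ⁆ ∣) (∣⁅x⁆∣≡1 u)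
                 (⊂⇒∣∣<∣∣ {P = ⁅ u ⁆} (λ i → ∪⁺ˡ) (≢⇒∉⁅⁆ (u≢fu ∘ sym)) (∪⁺ʳ (x∈⁅x⁆ (f u))))

    preimage-closed : ∀ s → s ∈ S → s ∈ A → f s ∈ ⁅ u ⁆ ∪ ⁅ f u ⁆ → s ∈ ⁅ u ⁆ ∪ ⁅ f u ⁆
    preimage-closed s s∈S s∈A fs∈ with ∪⁻ fs∈
    ... | inj₁ fs∈⁅u⁆  =
      contradiction (subst (_∈ image A) (∈⁅⁆⇒≡ fs∈⁅u⁆) (image-intro s∈S s∈A)) (≡false⇒≢true u∉img)
    ... | inj₂ fs∈⁅fu⁆ = ∪⁺ˡ (≡⇒∈⁅⁆ (injective s u s∈S u∈S (∈⁅⁆⇒≡ fs∈⁅fu⁆)))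

    covers : Covers G ((u , f u) ∷ []) (S ∩ (⁅ u ⁆ ∪ ⁅ f u ⁆))
    covers s s∈ with ∪⁻ (proj₂ (∩⁻ s∈))
    ... | inj₁ s∈⁅u⁆  with refl ← ∈⁅⁆⇒≡ s∈⁅u⁆  = f u , s~fs u u∈S , here (joins-fw u (f u))
    ... | inj₂ s∈⁅fu⁆ with refl ← ∈⁅⁆⇒≡ s∈⁅fu⁆ =
      u , trans (adj-sym G _ _) (s~fs u u∈S) , here (joins-bw u (f u))

  -- When every vertex of A is an image of S ∩ A, following preimages from v runs around a cycle of f.
  module CyclePiece {A} (A⊆image : ∀ u → u ∈ A → u ∈ image A) {v} (v∈A : v ∈ A) where

    preimage : ∀ {u} → u ∈ A → ∃ λ s → s ∈ S × s ∈ A × f s ≡ u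
    preimage {u} u∈A = image-witness (A⊆image u u∈A)

    orbit : ℕ → ∃ (_∈ A)
    orbit zero    = v , v∈A
    orbit (suc i) = let s , _ , s∈A , _ = preimage (proj₂ (orbit i)) in s , s∈A

    c : ℕ → Fin n
    c = proj₁ ∘ orbit

    c∈A : ∀ i → c i ∈ A
    c∈A = proj₂ ∘ orbit

    c-suc∈S : ∀ i → c (suc i) ∈ S
    c-suc∈S i = proj₁ (proj₂ (preimage (c∈A i)))

    f-c-suc : ∀ i → f (c (suc i)) ≡ c i
    f-c-suc i = proj₂ (proj₂ (proj₂ (preimage (c∈A i))))

    walk : ∀ i → adj G (c i) (c (suc i)) ≡ true
    walk i = trans (adj-sym G _ _)
                   (subst (λ u → adj G (c (suc i)) u ≡ true) (f-c-suc i) (s~fs _ (c-suc∈S i)))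

    open Periodic c f f-c-suc using (period)

    L : ℕ
    L = proj₁ period

    open ClosedWalk G c L walk (proj₁ (proj₂ period)) (proj₂ (proj₂ period))

    odd⇒long : Odd (suc L) → 2 * k + 1 ≤ suc L
    odd⇒long (zero  , 1+L≡1)   = contradiction (suc-injective 1+L≡1) nontrivial
    odd⇒long (suc t , 1+L≡3+2t) = girth (suc L) (suc t , 1+L≡3+2t) (cycle , is-cycle 3≤1+L)
      where
      3≤1+L : 3 ≤ suc L
      3≤1+L = subst (3 ≤_) (sym 1+L≡3+2t) (s≤s (*-monoʳ-≤ 2 (s≤s z≤n)))

    q : ℕ
    q = proj₁ (cycle-cost k (suc L) odd⇒long)

    1+L≤2q : suc L ≤ 2 * q
    1+L≤2q = proj₁ (proj₂ (cycle-cost k (suc L) odd⇒long))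

    piece : Piece A
    piece = record
      { part            = range cycle
      ; edges           = pairs c q
      ; part⊆A          = λ u u∈ →
          let i , ci≡u = range-witness {g = cycle} u∈ in subst (_∈ A) ci≡u (c∈A (toℕ i))
      ; nonempty        = ≤-trans (s≤s z≤n) (≤∣range∣ cycle-injective)
      ; preimage-closed = preimage-closed
      ; covers          = covers
      ; cost            = begin
          (2 * k + 1) * length (pairs c q) ≡⟨ cong ((2 * k + 1) *_) (length-pairs c q) ⟩
          (2 * k + 1) * q                  ≤⟨ proj₂ (proj₂ (cycle-cost k (suc L) odd⇒long)) ⟩
          (k + 1) * suc L                  ≤⟨ *-monoʳ-≤ (k + 1) (≤∣range∣ cycle-injective) ⟩
          (k + 1) * ∣ range cycle ∣        ∎
      }
      where
      open ≤-Reasoning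

      preimage-closed : ∀ s → s ∈ S → s ∈ A → f s ∈ range cycle → s ∈ range cycle
      preimage-closed s s∈S s∈A fs∈ =
        let i , ci≡fs = range-witness {g = cycle} fs∈
            s≡c-suc-i = injective s _ s∈S (c-suc∈S (toℕ i)) (trans (sym ci≡fs) (sym (f-c-suc (toℕ i))))
        in  subst (_∈ range cycle) (sym (trans s≡c-suc-i (c-suc≡cycle-next i)))
                  (range-intro cycle (next i))

      covers : Covers G (pairs c q) (S ∩ range cycle)
      covers s s∈ with range-witness {g = cycle} (proj₂ (∩⁻ s∈))
      ... | i , refl = pairs-cover G c walk q (<-≤-trans (Fin.toℕ<n i) 1+L≤2q)

  piece : ∀ {A v} → Closed A → v ∈ A → Piece A
  piece {A} closed v∈A with any (A ─ image A) in found
  ... | false = CyclePiece.piece A⊆image v∈A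
    where
    A⊆image : ∀ u → u ∈ A → u ∈ image A
    A⊆image u u∈A with ∈-or-∉ (image A) u
    ... | inj₁ u∈img = u∈img
    ... | inj₂ u∉img =
      contradiction (trans (sym found) (any-intro {P = A ─ image A} (─⁺ u∈A u∉img))) λ ()
  ... | true with any-witness found
  ...   | u , u∈A─img with ─⁻ u∈A─img | ∈-or-∉ S u
  ...     | u∈A , u∉img | inj₁ u∈S = edge-piece closed u∈A u∉img u∈S
  ...     | u∈A , u∉img | inj₂ u∉S = singleton-piece u∈A u∉img u∉S

  CheapCover : (Fin n → Bool) → Set
  CheapCover A =
    Σ (List (Edge n)) λ F → Covers G F (S ∩ A) × (2 * k + 1) * length F ≤ (k + 1) * ∣ A ∣

  extend : ∀ {A} (P : Piece A) → CheapCover (A ─ Piece.part P) → CheapCover A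
  extend {A} P (F , covers-rest , cost-rest) = edges ++ F , covers-all , cost-all
    where
    open Piece P

    covers-all : Covers G (edges ++ F) (S ∩ A)
    covers-all s s∈ with ∩⁻ s∈ | ∈-or-∉ part s
    ... | s∈S , _   | inj₁ s∈B = Covers-++ˡ {G = G} F covers s (∩⁺ s∈S s∈B)
    ... | s∈S , s∈A | inj₂ s∉B = Covers-++ʳ {G = G} edges covers-rest s (∩⁺ s∈S (─⁺ s∈A s∉B))

    cost-all : (2 * k + 1) * length (edges ++ F) ≤ (k + 1) * ∣ A ∣
    cost-all = begin
      (2 * k + 1) * length (edges ++ F)
        ≡⟨ cong ((2 * k + 1) *_) (List.length-++ edges) ⟩
      (2 * k + 1) * (length edges + length F)
        ≡⟨ *-distribˡ-+ (2 * k + 1) (length edges) _ ⟩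
      (2 * k + 1) * length edges + (2 * k + 1) * length F
        ≤⟨ +-mono-≤ cost cost-rest ⟩
      (k + 1) * ∣ part ∣ + (k + 1) * ∣ A ─ part ∣
        ≡⟨ *-distribˡ-+ (k + 1) ∣ part ∣ _ ⟨
      (k + 1) * (∣ part ∣ + ∣ A ─ part ∣)
        ≤⟨ *-monoʳ-≤ (k + 1) (⊆⇒∣∣+∣─∣≤∣∣ part⊆A) ⟩
      (k + 1) * ∣ A ∣
        ∎
      where open ≤-Reasoning

  empty-cover : ∀ {A} → ¬ 1 ≤ ∣ A ∣ → CheapCover A
  empty-cover {A} ∣A∣≱1 =
    [] , (λ s s∈ → contradiction (∈⇒1≤∣∣ {P = A} (proj₂ (∩⁻ s∈))) ∣A∣≱1)
       , ≤-trans (≤-reflexive (*-zeroʳ (2 * k + 1))) z≤n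

  cover-bounded : ∀ m {A} → ∣ A ∣ ≤ m → Closed A → CheapCover A
  cover-bounded zero    ∣A∣≤0 _ = empty-cover (λ 1≤∣A∣ → contradiction (≤-trans 1≤∣A∣ ∣A∣≤0) λ ())
  cover-bounded (suc m) {A} ∣A∣≤1+m closed with 1 ≤? ∣ A ∣
  ... | no  ∣A∣≱1 = empty-cover ∣A∣≱1
  ... | yes 1≤∣A∣ =
    let P = piece closed (proj₂ (1≤∣∣⇒∈ {P = A} 1≤∣A∣))
    in  extend P (cover-bounded m (∣─∣≤pred (Piece.part⊆A P) (Piece.nonempty P) ∣A∣≤1+m)
                                  (rest-closed closed P))

  cover : CheapCover full
  cover = cover-bounded n (≤-reflexive ∣full∣≡n) (λ _ _ _ → refl)

long-odd-cycles⇒Δ-removal : ∀ {n} (G : Graph n) k →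
                            (∀ m → Odd m → HasCycleOfLength G m → 2 * k + 1 ≤ m) →
                            Σ (Graph n) λ H → IsΔRemoval G H × (2 * k + 1) * removed G H ≤ (k + 1) * n
long-odd-cycles⇒Δ-removal {n} G k girth with 1 ≤? Δ G
... | no Δ≱1 = G , ((λ _ _ → id) , trans Δ≡0 (cong (_∸ 1) (sym Δ≡0))) , removed≤
  where
  Δ≡0 : Δ G ≡ 0
  Δ≡0 = n<1⇒n≡0 (≰⇒> Δ≱1)
  removed≤ : (2 * k + 1) * removed G G ≤ (k + 1) * n
  removed≤ rewrite n∸n≡0 (numEdges G) | *-zeroʳ (2 * k + 1) = z≤n
... | yes 1≤Δ =
  let f , matching = Hall.hall (adj G) (Hall.degrees⇒HallCondition (adj G) (Δ G) 1≤Δ Δ≤deg deg≤Δ′)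
      F , covers , cost = Cover.cover G (maxDegree G) f matching k girth
      H , removal , removed≤ =
        Δ-removal-of-cover G F 1≤Δ (Covers-⊆ {G = G} (λ s s∈S → ∩⁺ s∈S refl) covers)
  in  H , removal , (begin
        (2 * k + 1) * removed G H  ≤⟨ *-monoʳ-≤ (2 * k + 1) removed≤ ⟩
        (2 * k + 1) * length F     ≤⟨ cost ⟩
        (k + 1) * ∣ full {n} ∣     ≡⟨ cong ((k + 1) *_) ∣full∣≡n ⟩
        (k + 1) * n                ∎)
  where
  open ≤-Reasoning
  Δ≤deg : ∀ x → x ∈ maxDegree G → Δ G ≤ ∣ adj G x ∣
  Δ≤deg x x∈max = ≤-reflexive (trans (sym (maxDegree⇒≡ G x∈max)) (count≡∣∣ (adj G x)))
  deg≤Δ′ : ∀ w → ∣ (λ x → adj G x w) ∣ ≤ Δ G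
  deg≤Δ′ w = ≤-trans (≤-reflexive (trans (∣∣-cong (λ x → adj-sym G x w)) (sym (count≡∣∣ (adj G w)))))
                     (deg≤Δ G w)

theorem3p3 : (n k : ℕ) → 1 ≤ k → (G : Graph n) → OddGirth G (2 * k + 1)
    → Σ (Graph n) λ H → IsΔRemoval G H × (2 * k + 1) * removed G H ≤ (k + 1) * n
theorem3p3 n k _ G (_ , _ , no-shorter-odd-cycle) =
  long-odd-cycles⇒Δ-removal G k no-shorter-odd-cycle
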